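{- Let $G$ be a bush graph in which every bush has at most two edges. Then the expected weight of the greedy matching returned by the algorithm \textsc{Rgma} on $G$ is at least $\frac{2}{3}\,\mathrm{OPT}(G)$.
   Context: Graphs are finite, simple, undirected, with positive edge weights; the weight of a matching is the sum of its edge weights. With distinct edge weights $w_1>\dots>w_\ell$, a greedy matching is any matching that can be output by: $\mathcal{M}\leftarrow\emptyset$; for $i=1,\dots,\ell$, while the current edge set contains an edge of weight $w_i$, pick any such edge $e^*$, add it to $\mathcal{M}$ and delete all edges sharing an endpoint with $e^*$. $\mathrm{OPT}(G)$ is the maximum weight of a greedy matching of $G$. $G$ is a bush graph if for every $i$ the edges of weight $w_i$ form a star (all share a common vertex, the center); this star is the $i$-th bush. Algorithm \textsc{Rgma} on a bush graph: $\mathcal{M}\leftarrow\emptyset$; for $i=1,\dots,\ell$: let $G_i$ be the set of edges of weight $w_i$ still present in the current graph; if $G_i\neq\emptyset$, select an edge $e_i\in G_i$ uniformly at random, add it to $\mathcal{M}$, and delete from the current graph both endpoints of $e_i$ (with their incident edges) and all edges of $G_i$. Output $\mathcal{M}$.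
   Formalization: The edge weights $w_1>\dots>w_\ell$ are positive rationals. -}

module Defs where

open import Data.Nat as ℕ using (ℕ; suc)
open import Data.Integer using (+_)
open import Data.Rational using (ℚ; 0ℚ; 1ℚ; _+_; _*_; _/_; _<_; _≤_)
open import Data.List using (List; []; _∷_; [_]; map; concatMap; filter; length; _++_; foldr)
open import Data.List.Membership.Propositional using (_∈_; _∉_)
open import Data.List.Membership.DecPropositional ℕ._≟_ using (_∈?_)
open import Data.List.Relation.Unary.All using (All)
open import Data.List.Relation.Unary.AllPairs using (AllPairs)
open import Data.List.Relation.Unary.Linked using (Linked)
open import Data.Product using (_×_; _,_; proj₁; proj₂; ∃)
open import Data.Sum using (_⊎_)
open import Relation.Nullary using (¬_)
open import Relation.Nullary.Decidable using (¬?; _×-dec_)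
open import Relation.Binary.PropositionalEquality using (_≡_; _≢_)

Vertex : Set
Vertex = ℕ

-- A bush: all edges of one weight class, a star with a center and its leaves.
record Bush : Set where
  constructor bush
  field
    weight : ℚ
    center : Vertex
    leaves : List Vertex
open Bush public

record Edge : Set where
  constructor edge
  field
    end₁ : Vertex
    end₂ : Vertex
    wt   : ℚ
open Edge public

-- A weighted graph given by its bushes, listed in order of decreasing weight
-- (the i-th element is the i-th bush, with weight w_i).
BushGraph : Set
BushGraph = List Bush

bushEdges : Bush → List Edge
bushEdges b = map (λ l → edge (center b) l (weight b)) (leaves b)

edges : BushGraph → List Edge
edges G = concatMap bushEdges G

SameEnds : Edge → Edge → Set
SameEnds e e' = (end₁ e ≡ end₁ e' × end₂ e ≡ end₂ e') ⊎ (end₁ e ≡ end₂ e' × end₂ e ≡ end₁ e')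

IsBushGraph : BushGraph → Set
IsBushGraph G =
  All (λ e → end₁ e ≢ end₂ e) (edges G) ×
  AllPairs (λ e e' → ¬ SameEnds e e') (edges G) ×
  All (λ b → 0ℚ < weight b) G ×
  All (λ b → leaves b ≢ []) G ×
  Linked (λ b b' → weight b' < weight b) G

AtMostTwoEdgesPerBush : BushGraph → Set
AtMostTwoEdgesPerBush G = All (λ b → length (leaves b) ℕ.≤ 2) G

matchWeight : List Edge → ℚ
matchWeight M = foldr (λ e s → wt e + s) 0ℚ M

-- `used` = vertices already matched; an edge is still present iff neither
-- endpoint has been deleted.
Present : List Vertex → Edge → Set
Present used e = end₁ e ∉ used × end₂ e ∉ used

-- inner while-loop for one weight class with edge list es
data GreedyClass (es : List Edge) : List Vertex → List Edge → List Vertex → Set where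
  stop : ∀ {used} → All (λ e → ¬ Present used e) es → GreedyClass es used [] used
  pick : ∀ {used M used'} (e : Edge) → e ∈ es → Present used e →
         GreedyClass es (end₁ e ∷ end₂ e ∷ used) M used' →
         GreedyClass es used (e ∷ M) used'

-- outer loop over weight classes i = 1..ℓ (the edges of weight w_i are the i-th bush)
data Greedy : List Vertex → BushGraph → List Edge → Set where
  done : ∀ {used} → Greedy used [] []
  step : ∀ {used used' b G M₁ M₂} →
         GreedyClass (bushEdges b) used M₁ used' → Greedy used' G M₂ →
         Greedy used (b ∷ G) (M₁ ++ M₂)

GreedyMatching : BushGraph → List Edge → Set
GreedyMatching G M = Greedy [] G M

IsOPT : BushGraph → ℚ → Set
IsOPT G opt =
  (∃ λ M → GreedyMatching G M × matchWeight M ≡ opt) ×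
  (∀ M → GreedyMatching G M → matchWeight M ≤ opt)

-- Algorithm RGMA, as the exact output distribution: a list of
-- (probability, output matching) pairs.

available : List Vertex → Bush → List Edge
available used b =
  filter (λ e → ¬? (end₁ e ∈? used) ×-dec ¬? (end₂ e ∈? used)) (bushEdges b)

rgma : List Vertex → BushGraph → List (ℚ × List Edge)
rgma used [] = [ (1ℚ , []) ]
rgma used (b ∷ G) = go (available used b)
  where
  go : List Edge → List (ℚ × List Edge)
  go [] = rgma used G
  go (e₀ ∷ es) =
    concatMap
      (λ e → map (λ pm → (((+ 1) / suc (length es)) * proj₁ pm , e ∷ proj₂ pm))
                 (rgma (end₁ e ∷ end₂ e ∷ used) G))
      (e₀ ∷ es)

expectedWeight : BushGraph → ℚ
expectedWeight G = foldr (λ pm s → proj₁ pm * matchWeight (proj₂ pm) + s) 0ℚ (rgma [] G)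

module Submission where

-- The greedy optimum is computed by a recursion `opt U G` over the bushes, where
-- U is the list of already matched vertices: a bush with no available edge is
-- skipped, otherwise the best available edge is taken.  Every greedy matching
-- weighs at most `opt [] G`.  The combinatorial core is a vertex-deletion
-- lemma: when weights are non-increasing and non-negative, `opt` is antitone in
-- the set of used vertices, and deleting one more vertex lowers it by at most
-- the largest remaining weight.  Consequently the two edges c–l and c–l' of a
-- bush of weight w leave residual optima A, B with |A − B| ≤ w.
--
-- By induction over the bushes, RGMA from any used set U is a probability
-- distribution whose expected weight is at least (2/3)·opt U G: with one
-- available edge this is immediate, with two it is the arithmetic fact
-- (2/3)(w + A) ≤ ½(w + a) + ½(w + b) for a ≥ (2/3)A, b ≥ (2/3)B, A ≤ B + w.

open import Defs
open import Data.Integer using (+_)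
open import Data.Rational using (ℚ; _/_; _*_; _≤_; 0ℚ; 1ℚ; _+_)
open import Data.Rational.Properties
  using (≤-refl; ≤-trans; ≤-reflexive; <⇒≤; <-trans; ≤-decTotalOrder;
         +-mono-≤; +-monoʳ-≤; +-monoˡ-≤; *-monoˡ-≤-nonNeg;
         +-assoc; +-comm; +-identityˡ; *-identityˡ; *-identityʳ; module ≤-Reasoning)
open import Data.Rational.Solver using (module +-*-Solver)
open import Data.Nat as ℕ using (suc; s≤s)
import Data.Nat.Properties as ℕₚ
open import Data.List using (List; []; _∷_; map; concatMap; length; _++_; foldr)
open import Data.List.Properties using (filter-none; length-filter; length-map; ++-identityʳ)
open import Data.List.Membership.Propositional using (_∈_; _∉_)
open import Data.List.Membership.Propositional.Properties using (∈-filter⁺; ∈-filter⁻; ∈-map⁻)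
open import Data.List.Membership.DecPropositional ℕ._≟_ using (_∈?_)
open import Data.List.Relation.Binary.Subset.Propositional using (_⊆_)
open import Data.List.Relation.Binary.Subset.Propositional.Properties
  using (⊆-refl; ⊆-trans; ∷⁺ʳ; xs⊆x∷xs; ⊆-reflexive-↭; filter⁺′)
open import Data.List.Relation.Binary.Permutation.Propositional using (↭-refl; ↭-swap)
open import Data.List.Relation.Unary.Any using (here; there)
open import Data.List.Relation.Unary.All using (All; []; _∷_)
import Data.List.Relation.Unary.All as All
open import Data.List.Relation.Unary.AllPairs using (AllPairs; []; _∷_)
import Data.List.Relation.Unary.AllPairs as AllPairs
open import Data.List.Relation.Unary.Linked.Properties using (Linked⇒AllPairs)
open import Relation.Binary.Bundles using (DecTotalOrder)
open import Data.List.Extrema (DecTotalOrder.totalOrder ≤-decTotalOrder)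
  using (argmax; f[⊥]≤f[argmax]; f[xs]≤f[argmax]; argmax-sel)
open import Data.Product using (_×_; _,_; proj₁; proj₂; ∃)
open import Data.Sum using (_⊎_; inj₁; inj₂)
open import Data.Empty using (⊥-elim)
open import Relation.Nullary using (¬_; yes; no)
open import Relation.Unary using (Decidable)
open import Relation.Nullary.Decidable using (¬?; _×-dec_)
open import Relation.Binary.PropositionalEquality
  using (_≡_; refl; sym; trans; cong; cong₂; subst; subst₂)

half third twoThirds : ℚ
half = (+ 1) / 2
third = (+ 1) / 3
twoThirds = (+ 2) / 3

-- A bush with a single available edge of weight w ≥ 0 followed by a
-- 2/3-approximation a of the residual optimum A.
single-edge-bound : ∀ w A a → 0ℚ ≤ w → twoThirds * A ≤ a → twoThirds * (w + A) ≤ w + a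
single-edge-bound w A a 0≤w ⅔A≤a = begin
  twoThirds * (w + A)                 ≡⟨ split ⟩
  (twoThirds * A + twoThirds * w) + third * 0ℚ
    ≤⟨ +-mono-≤ (+-monoˡ-≤ (twoThirds * w) ⅔A≤a) (*-monoˡ-≤-nonNeg third 0≤w) ⟩
  (a + twoThirds * w) + third * w     ≡⟨ merge ⟩
  w + a                               ∎
  where
  open ≤-Reasoning
  open +-*-Solver
  split : twoThirds * (w + A) ≡ (twoThirds * A + twoThirds * w) + third * 0ℚ
  split = solve 2 (λ w A → con twoThirds :* (w :+ A)
                         := (con twoThirds :* A :+ con twoThirds :* w) :+ con third :* con 0ℚ) refl w A
  merge : (a + twoThirds * w) + third * w ≡ w + a
  merge = solve 2 (λ w a → (a :+ con twoThirds :* w) :+ con third :* w := w :+ a) refl w a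

-- A bush with two available edges, each chosen with probability ½; the
-- greedy optimum takes the first (residual optimum A), and A ≤ B + w.
two-edge-bound : ∀ w A B a b → twoThirds * A ≤ a → twoThirds * B ≤ b → A ≤ B + w →
                 twoThirds * (w + A) ≤ half * (w + a) + half * (w + b)
two-edge-bound w A B a b ⅔A≤a ⅔B≤b A≤B+w = begin
  twoThirds * (w + A)                               ≡⟨ split ⟩
  (twoThirds * w + third * A) + third * A
    ≤⟨ +-monoʳ-≤ (twoThirds * w + third * A) (*-monoˡ-≤-nonNeg third A≤B+w) ⟩
  (twoThirds * w + third * A) + third * (B + w)     ≡⟨ regroup ⟩
  half * (w + twoThirds * A) + half * (w + twoThirds * B)
    ≤⟨ +-mono-≤ (*-monoˡ-≤-nonNeg half (+-monoʳ-≤ w ⅔A≤a))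
                (*-monoˡ-≤-nonNeg half (+-monoʳ-≤ w ⅔B≤b)) ⟩
  half * (w + a) + half * (w + b)                   ∎
  where
  open ≤-Reasoning
  open +-*-Solver
  split : twoThirds * (w + A) ≡ (twoThirds * w + third * A) + third * A
  split = solve 2 (λ w A → con twoThirds :* (w :+ A)
                         := (con twoThirds :* w :+ con third :* A) :+ con third :* A) refl w A
  regroup : (twoThirds * w + third * A) + third * (B + w)
          ≡ half * (w + twoThirds * A) + half * (w + twoThirds * B)
  regroup = solve 3 (λ w A B → (con twoThirds :* w :+ con third :* A) :+ con third :* (B :+ w)
                             := con half :* (w :+ con twoThirds :* A) :+ con half :* (w :+ con twoThirds :* B))
                    refl w A B

Distribution : Set
Distribution = List (ℚ × List Edge)

mass : Distribution → ℚ
mass = foldr (λ pm s → proj₁ pm + s) 0ℚ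

expectation : Distribution → ℚ
expectation = foldr (λ pm s → proj₁ pm * matchWeight (proj₂ pm) + s) 0ℚ

mass-++ : ∀ D E → mass (D ++ E) ≡ mass D + mass E
mass-++ [] E = sym (+-identityˡ (mass E))
mass-++ ((p , _) ∷ D) E = trans (cong (_+_ p) (mass-++ D E)) (sym (+-assoc p (mass D) (mass E)))

expectation-++ : ∀ D E → expectation (D ++ E) ≡ expectation D + expectation E
expectation-++ [] E = sym (+-identityˡ (expectation E))
expectation-++ ((p , m) ∷ D) E =
  trans (cong (_+_ (p * matchWeight m)) (expectation-++ D E))
        (sym (+-assoc (p * matchWeight m) (expectation D) (expectation E)))

-- Scale every probability by k and prepend the edge e to every matching:
-- the branch of RGMA in which e is chosen with probability k.
extend : ℚ → Edge → Distribution → Distribution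
extend k e = map (λ pm → (k * proj₁ pm , e ∷ proj₂ pm))

mass-extend : ∀ k e D → mass (extend k e D) ≡ k * mass D
mass-extend k e [] = solve 1 (λ k → con 0ℚ := k :* con 0ℚ) refl k
  where open +-*-Solver
mass-extend k e ((p , m) ∷ D) =
  trans (cong (_+_ (k * p)) (mass-extend k e D))
        (solve 3 (λ k p T → k :* p :+ k :* T := k :* (p :+ T)) refl k p (mass D))
  where open +-*-Solver

expectation-extend : ∀ k e D → expectation (extend k e D) ≡ k * (wt e * mass D + expectation D)
expectation-extend k e [] = solve 2 (λ k w → con 0ℚ := k :* (w :* con 0ℚ :+ con 0ℚ)) refl k (wt e)
  where open +-*-Solver
expectation-extend k e ((p , m) ∷ D) =
  trans (cong (_+_ ((k * p) * (wt e + matchWeight m))) (expectation-extend k e D))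
        (solve 6 (λ k p w M T E → (k :* p) :* (w :+ M) :+ k :* (w :* T :+ E)
                                := k :* (w :* (p :+ T) :+ (p :* M :+ E)))
               refl k p (wt e) (matchWeight m) (mass D) (expectation D))
  where open +-*-Solver

extend-probability : ∀ k e D → mass D ≡ 1ℚ →
                     mass (extend k e D) ≡ k * 1ℚ × expectation (extend k e D) ≡ k * (wt e + expectation D)
extend-probability k e D mass≡1 =
  trans (mass-extend k e D) (cong (k *_) mass≡1) ,
  trans (expectation-extend k e D)
        (cong (λ t → k * (t + expectation D)) (trans (cong (wt e *_) mass≡1) (*-identityʳ (wt e))))

branches : List Vertex → BushGraph → List Edge → Distribution
branches U G [] = rgma U G
branches U G (e₀ ∷ es) =
  concatMap (λ e → extend ((+ 1) / suc (length es)) e (rgma (end₁ e ∷ end₂ e ∷ U) G)) (e₀ ∷ es)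

rgma-step : ∀ U b G → rgma U (b ∷ G) ≡ branches U G (available U b)
rgma-step U b G with available U b
... | [] = refl
... | e ∷ es = refl

mutual
  opt : List Vertex → BushGraph → ℚ
  opt U [] = 0ℚ
  opt U (b ∷ G) = optAmong U G (available U b)

  optAmong : List Vertex → BushGraph → List Edge → ℚ
  optAmong U G [] = opt U G
  optAmong U G (e ∷ es) = pickValue U G (argmax (pickValue U G) e es)

  pickValue : List Vertex → BushGraph → Edge → ℚ
  pickValue U G e = wt e + opt (end₁ e ∷ end₂ e ∷ U) G

pickValue≤optAmong : ∀ U G {xs e} → e ∈ xs → pickValue U G e ≤ optAmong U G xs
pickValue≤optAmong U G {e₀ ∷ es} (here refl) = f[⊥]≤f[argmax] {f = pickValue U G} e₀ es
pickValue≤optAmong U G {e₀ ∷ es} (there e∈es) =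
  All.lookup (f[xs]≤f[argmax] {f = pickValue U G} e₀ es) e∈es

optAmong-attained : ∀ U G xs → (xs ≡ [] × optAmong U G xs ≡ opt U G)
                               ⊎ (∃ λ e → e ∈ xs × optAmong U G xs ≡ pickValue U G e)
optAmong-attained U G [] = inj₁ (refl , refl)
optAmong-attained U G (e₀ ∷ es) with argmax-sel (pickValue U G) e₀ es
... | inj₁ best≡e₀ = inj₂ (e₀ , here refl , cong (pickValue U G) best≡e₀)
... | inj₂ best∈es = inj₂ (_ , there best∈es , refl)

Present? : (U : List Vertex) → Decidable (Present U)
Present? U e = ¬? (end₁ e ∈? U) ×-dec ¬? (end₂ e ∈? U)

bushEdge : ∀ {b e} → e ∈ bushEdges b → end₁ e ≡ center b × wt e ≡ weight b
bushEdge {b} e∈b with ∈-map⁻ (λ l → edge (center b) l (weight b)) e∈b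
... | _ , _ , refl = refl , refl

available⁻ : ∀ {U} b {e} → e ∈ available U b → e ∈ bushEdges b × Present U e
available⁻ {U} _ = ∈-filter⁻ (Present? U)

available⁺ : ∀ {U} b {e} → e ∈ bushEdges b → Present U e → e ∈ available U b
available⁺ {U} _ = ∈-filter⁺ (Present? U)

unavailable : ∀ {V} b {e} → available V b ≡ [] → e ∈ bushEdges b → ¬ Present V e
unavailable b AV≡[] e∈b present with subst (_ ∈_) AV≡[] (available⁺ b e∈b present)
... | ()

available-antitone : ∀ {U V} b → U ⊆ V → available V b ⊆ available U b
available-antitone {U} {V} b U⊆V =
  filter⁺′ (Present? V) (Present? U) (λ (∉V₁ , ∉V₂) → (λ ∈U → ∉V₁ (U⊆V ∈U)) , (λ ∈U → ∉V₂ (U⊆V ∈U)))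
           (⊆-refl {x = bushEdges b})

incident-to-deleted : ∀ {U v e} → Present U e → ¬ Present (v ∷ U) e → end₁ e ≡ v ⊎ end₂ e ≡ v
incident-to-deleted {U} {v} {e} (∉U₁ , ∉U₂) absent with end₁ e ℕ.≟ v | end₂ e ℕ.≟ v
... | yes e₁≡v | _ = inj₁ e₁≡v
... | no _ | yes e₂≡v = inj₂ e₂≡v
... | no e₁≢v | no e₂≢v = ⊥-elim (absent (∉ e₁≢v ∉U₁ , ∉ e₂≢v ∉U₂))
  where
  ∉ : ∀ {x} → ¬ x ≡ v → x ∉ U → x ∉ v ∷ U
  ∉ x≢v _ (here x≡v) = x≢v x≡v
  ∉ _ x∉U (there x∈U) = x∉U x∈U

covering-vertex : ∀ {U V e} → U ⊆ V → ¬ Present V e → ∃ λ x → (end₁ e ∷ end₂ e ∷ U) ⊆ (x ∷ V)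
covering-vertex {U} {V} {e} U⊆V absent with end₁ e ∈? V | end₂ e ∈? V
... | yes e₁∈V | _ = end₂ e , λ { (here refl) → there e₁∈V ; (there (here refl)) → here refl
                               ; (there (there ∈U)) → there (U⊆V ∈U) }
... | no _ | yes e₂∈V = end₁ e , λ { (here refl) → here refl ; (there (here refl)) → there e₂∈V
                                   ; (there (there ∈U)) → there (U⊆V ∈U) }
... | no e₁∉V | no e₂∉V = ⊥-elim (absent (e₁∉V , e₂∉V))

swap-⊆ : ∀ {U} (a c : Vertex) → (a ∷ c ∷ U) ⊆ (c ∷ a ∷ U)
swap-⊆ {U} a c = ⊆-reflexive-↭ (↭-swap a c (↭-refl {x = U}))

-- Within one bush the greedy loop picks at most one edge, since all edges
-- share the center; so a greedy matching is bounded by the recursion for opt.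
greedy≤opt : ∀ {U G M} → Greedy U G M → matchWeight M ≤ opt U G
greedy≤opt done = ≤-refl
greedy≤opt {U} {b ∷ G} (step {M₂ = M₂} (stop none-present) g) =
  subst (λ xs → matchWeight M₂ ≤ optAmong U G xs) (sym (filter-none (Present? U) none-present))
        (greedy≤opt g)
greedy≤opt {U} {b ∷ G} (step (pick e e∈b present (stop _)) g) =
  ≤-trans (+-monoʳ-≤ (wt e) (greedy≤opt g)) (pickValue≤optAmong U G (available⁺ b e∈b present))
greedy≤opt {U} {b ∷ G} (step (pick e e∈b _ (pick e′ e′∈b (center-unused , _) _)) _) =
  ⊥-elim (center-unused (here (trans (proj₁ (bushEdge e′∈b)) (sym (proj₁ (bushEdge e∈b))))))

NonIncreasing : BushGraph → Set
NonIncreasing = AllPairs (λ b b′ → weight b′ ≤ weight b)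

NonNegativeWeights : BushGraph → Set
NonNegativeWeights = All (λ b → 0ℚ ≤ weight b)

WeightsAtMost : ℚ → BushGraph → Set
WeightsAtMost w = All (λ b → weight b ≤ w)

Antitone : BushGraph → Set
Antitone G = ∀ {U V} → U ⊆ V → opt V G ≤ opt U G

Lipschitz : ℚ → BushGraph → Set
Lipschitz w G = ∀ U v → opt U G ≤ opt (v ∷ U) G + w

-- A bush whose edges are no longer available is skipped; then opt V G is
-- compared with an edge e picked from U through a vertex x covering e.
antitone-step : ∀ b G → Antitone G → Lipschitz (weight b) G → Antitone (b ∷ G)
antitone-step b G antitone lipschitz {U} {V} U⊆V with optAmong-attained V G (available V b)
... | inj₂ (e , e∈AV , opt≡) = begin
  optAmong V G (available V b)   ≡⟨ opt≡ ⟩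
  pickValue V G e                ≤⟨ +-monoʳ-≤ (wt e) (antitone (∷⁺ʳ _ (∷⁺ʳ _ U⊆V))) ⟩
  pickValue U G e                ≤⟨ pickValue≤optAmong U G (available-antitone b U⊆V e∈AV) ⟩
  optAmong U G (available U b)   ∎
  where open ≤-Reasoning
... | inj₁ (AV≡[] , opt≡) with optAmong-attained U G (available U b)
...   | inj₁ (_ , opt≡′) = ≤-trans (≤-reflexive opt≡) (≤-trans (antitone U⊆V) (≤-reflexive (sym opt≡′)))
...   | inj₂ (e , e∈AU , opt≡′)
  with covering-vertex {e = e} U⊆V (unavailable b AV≡[] (proj₁ (available⁻ b e∈AU)))
...     | x , covered = begin
  optAmong V G (available V b)         ≡⟨ opt≡ ⟩
  opt V G                              ≤⟨ lipschitz V x ⟩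
  opt (x ∷ V) G + weight b             ≤⟨ +-monoˡ-≤ (weight b) (antitone covered) ⟩
  opt (end₁ e ∷ end₂ e ∷ U) G + weight b
    ≡⟨ trans (+-comm _ (weight b)) (cong (_+ _) (sym (proj₂ (bushEdge (proj₁ (available⁻ b e∈AU)))))) ⟩
  pickValue U G e                      ≡⟨ sym opt≡′ ⟩
  optAmong U G (available U b)         ∎
  where open ≤-Reasoning

sibling-bound : ∀ b G U e e′ → Antitone G → Lipschitz (weight b) G →
                e ∈ bushEdges b → e′ ∈ bushEdges b →
                opt (end₁ e ∷ end₂ e ∷ U) G ≤ opt (end₁ e′ ∷ end₂ e′ ∷ U) G + weight b
sibling-bound b G U e e′ antitone lipschitz e∈b e′∈b = begin
  opt (end₁ e ∷ end₂ e ∷ U) G                ≤⟨ antitone center-used ⟩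
  opt (center b ∷ U) G                       ≤⟨ lipschitz (center b ∷ U) (end₂ e′) ⟩
  opt (end₂ e′ ∷ center b ∷ U) G + weight b  ≤⟨ +-monoˡ-≤ (weight b) (antitone ends-used) ⟩
  opt (end₁ e′ ∷ end₂ e′ ∷ U) G + weight b   ∎
  where
  open ≤-Reasoning
  center-used : (center b ∷ U) ⊆ (end₁ e ∷ end₂ e ∷ U)
  center-used (here refl) = here (sym (proj₁ (bushEdge e∈b)))
  center-used (there ∈U) = there (there ∈U)
  ends-used : (end₁ e′ ∷ end₂ e′ ∷ U) ⊆ (end₂ e′ ∷ center b ∷ U)
  ends-used (here refl) = there (here (proj₁ (bushEdge e′∈b)))
  ends-used (there (here refl)) = here refl
  ends-used (there (there ∈U)) = there (there ∈U)

incident-⊆ : ∀ {U v} e → end₁ e ≡ v ⊎ end₂ e ≡ v → (v ∷ U) ⊆ (end₁ e ∷ end₂ e ∷ U)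
incident-⊆ e (inj₁ e₁≡v) (here refl) = here (sym e₁≡v)
incident-⊆ e (inj₂ e₂≡v) (here refl) = there (here (sym e₂≡v))
incident-⊆ e _ (there ∈U) = there (there ∈U)

-- Either nothing is left in the bush (and skipping loses at most w), or a
-- sibling edge c–l′ is available, whose value is within weight b of the lost
-- edge c–v (the center itself cannot be v, or no sibling would be left).
lost-edge-bound : ∀ b G w U v e → weight b ≤ w → Antitone G → Lipschitz (weight b) G →
                  e ∈ available U b → end₁ e ≡ v ⊎ end₂ e ≡ v →
                  pickValue U G e ≤ optAmong (v ∷ U) G (available (v ∷ U) b) + w
lost-edge-bound b G w U v e b≤w antitone lipschitz e∈AU incident
  with optAmong-attained (v ∷ U) G (available (v ∷ U) b)
... | inj₁ (_ , opt≡) = begin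
  wt e + opt (end₁ e ∷ end₂ e ∷ U) G   ≤⟨ +-mono-≤ (≤-reflexive wt≡) (antitone (incident-⊆ e incident)) ⟩
  weight b + opt (v ∷ U) G             ≤⟨ +-monoˡ-≤ _ b≤w ⟩
  w + opt (v ∷ U) G                    ≡⟨ trans (+-comm w _) (cong (_+ w) (sym opt≡)) ⟩
  optAmong (v ∷ U) G (available (v ∷ U) b) + w ∎
  where
  open ≤-Reasoning
  wt≡ : wt e ≡ weight b
  wt≡ = proj₂ (bushEdge (proj₁ (available⁻ b e∈AU)))
... | inj₂ (e′ , e′∈AV , opt≡) = via-sibling incident (available⁻ b e′∈AV)
  where
  e∈b : e ∈ bushEdges b
  e∈b = proj₁ (available⁻ b e∈AU)
  via-sibling : end₁ e ≡ v ⊎ end₂ e ≡ v → e′ ∈ bushEdges b × Present (v ∷ U) e′ →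
                pickValue U G e ≤ optAmong (v ∷ U) G (available (v ∷ U) b) + w
  via-sibling (inj₁ e₁≡v) (e′∈b , center-unused , _) =
    ⊥-elim (center-unused (here (trans (proj₁ (bushEdge e′∈b))
                                       (trans (sym (proj₁ (bushEdge e∈b))) e₁≡v))))
  via-sibling (inj₂ e₂≡v) (e′∈b , _) = begin
    wt e + opt (end₁ e ∷ end₂ e ∷ U) G
      ≤⟨ +-mono-≤ (≤-reflexive wt≡) (antitone v-redundant) ⟩
    weight b + opt (end₁ e ∷ end₂ e ∷ v ∷ U) G
      ≤⟨ +-monoʳ-≤ (weight b) (sibling-bound b G (v ∷ U) e e′ antitone lipschitz e∈b e′∈b) ⟩
    weight b + (opt (end₁ e′ ∷ end₂ e′ ∷ v ∷ U) G + weight b)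
      ≡⟨ trans (sym (+-assoc (weight b) _ (weight b))) (cong (λ t → t + _ + weight b) (sym wt′≡)) ⟩
    pickValue (v ∷ U) G e′ + weight b
      ≤⟨ +-mono-≤ (pickValue≤optAmong (v ∷ U) G e′∈AV) b≤w ⟩
    optAmong (v ∷ U) G (available (v ∷ U) b) + w  ∎
    where
    open ≤-Reasoning
    wt≡ : wt e ≡ weight b
    wt≡ = proj₂ (bushEdge e∈b)
    wt′≡ : wt e′ ≡ weight b
    wt′≡ = proj₂ (bushEdge e′∈b)
    v-redundant : (end₁ e ∷ end₂ e ∷ v ∷ U) ⊆ (end₁ e ∷ end₂ e ∷ U)
    v-redundant (here refl) = here refl
    v-redundant (there (here refl)) = there (here refl)
    v-redundant (there (there (here refl))) = there (here (sym e₂≡v))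
    v-redundant (there (there (there ∈U))) = there (there ∈U)

-- The best edge from U either survives using v (and the induction hypothesis
-- applies to what follows it) or is lost, handled by lost-edge-bound.
lipschitz-step : ∀ b G w → weight b ≤ w → Antitone G → Lipschitz w G → Lipschitz (weight b) G →
                 Lipschitz w (b ∷ G)
lipschitz-step b G w b≤w antitone lipschitz-w lipschitz-b U v with optAmong-attained U G (available U b)
... | inj₁ (AU≡[] , opt≡) with optAmong-attained (v ∷ U) G (available (v ∷ U) b)
...   | inj₁ (_ , opt≡′) =
  ≤-trans (≤-reflexive opt≡) (≤-trans (lipschitz-w U v) (≤-reflexive (cong (_+ w) (sym opt≡′))))
...   | inj₂ (e , e∈AV , _) with subst (e ∈_) AU≡[] (available-antitone b (xs⊆x∷xs U v) e∈AV)
...     | ()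
lipschitz-step b G w b≤w antitone lipschitz-w lipschitz-b U v | inj₂ (e , e∈AU , opt≡)
  with Present? (v ∷ U) e
... | no absent = ≤-trans (≤-reflexive opt≡)
                    (lost-edge-bound b G w U v e b≤w antitone lipschitz-b e∈AU
                       (incident-to-deleted {U} {v} {e} (proj₂ (available⁻ b e∈AU)) absent))
... | yes present = begin
  optAmong U G (available U b)                        ≡⟨ opt≡ ⟩
  wt e + opt (end₁ e ∷ end₂ e ∷ U) G                  ≤⟨ +-monoʳ-≤ (wt e) (lipschitz-w _ v) ⟩
  wt e + (opt (v ∷ end₁ e ∷ end₂ e ∷ U) G + w)        ≤⟨ +-monoʳ-≤ (wt e) (+-monoˡ-≤ w (antitone reorder)) ⟩
  wt e + (opt (end₁ e ∷ end₂ e ∷ v ∷ U) G + w)        ≡⟨ sym (+-assoc (wt e) _ w) ⟩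
  pickValue (v ∷ U) G e + w
    ≤⟨ +-monoˡ-≤ w (pickValue≤optAmong (v ∷ U) G (available⁺ b (proj₁ (available⁻ b e∈AU)) present)) ⟩
  optAmong (v ∷ U) G (available (v ∷ U) b) + w        ∎
  where
  open ≤-Reasoning
  reorder : (end₁ e ∷ end₂ e ∷ v ∷ U) ⊆ (v ∷ end₁ e ∷ end₂ e ∷ U)
  reorder = ⊆-trans (∷⁺ʳ (end₁ e) (swap-⊆ {U} (end₂ e) v)) (swap-⊆ {end₂ e ∷ U} (end₁ e) v)

deletion-bounds : ∀ G → NonIncreasing G → NonNegativeWeights G →
                  Antitone G × (∀ w → 0ℚ ≤ w → WeightsAtMost w G → Lipschitz w G)
deletion-bounds [] _ _ = (λ _ → ≤-refl) , λ w 0≤w _ _ _ → ≤-trans 0≤w (≤-reflexive (sym (+-identityˡ w)))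
deletion-bounds (b ∷ G) (later≤b ∷ nonIncreasing) (0≤b ∷ nonNegative) =
  antitone-step b G antitone (lipschitz (weight b) 0≤b later≤b) ,
  λ { w _ (b≤w ∷ bounded) → lipschitz-step b G w b≤w antitone (lipschitz w (≤-trans 0≤b b≤w) bounded)
                                           (lipschitz (weight b) 0≤b later≤b) }
  where
  antitone : Antitone G
  antitone = proj₁ (deletion-bounds G nonIncreasing nonNegative)
  lipschitz : ∀ w → 0ℚ ≤ w → WeightsAtMost w G → Lipschitz w G
  lipschitz = proj₂ (deletion-bounds G nonIncreasing nonNegative)

Guarantee : List Vertex → BushGraph → Set
Guarantee U G = mass (rgma U G) ≡ 1ℚ × twoThirds * opt U G ≤ expectation (rgma U G)

bush-guarantee : ∀ b G U → 0ℚ ≤ weight b → Antitone G → Lipschitz (weight b) G →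
                 (∀ U → Guarantee U G) →
                 ∀ xs → (∀ {e} → e ∈ xs → e ∈ bushEdges b) → length xs ℕ.≤ 2 →
                 mass (branches U G xs) ≡ 1ℚ × twoThirds * optAmong U G xs ≤ expectation (branches U G xs)
bush-guarantee b G U 0≤b antitone lipschitz guarantee [] _ _ = guarantee U
bush-guarantee b G U 0≤b antitone lipschitz guarantee (e ∷ []) in-bush _ =
  trans (cong mass (++-identityʳ branch)) (proj₁ extended) ,
  (begin
    twoThirds * (wt e + opt ends G)             ≤⟨ single-edge-bound (wt e) _ _ 0≤e (proj₂ (guarantee ends)) ⟩
    wt e + expectation (rgma ends G)            ≡⟨ sym (*-identityˡ _) ⟩
    1ℚ * (wt e + expectation (rgma ends G))     ≡⟨ sym (proj₂ extended) ⟩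
    expectation branch                          ≡⟨ cong expectation (sym (++-identityʳ branch)) ⟩
    expectation (branch ++ [])                  ∎)
  where
  open ≤-Reasoning
  ends : List Vertex
  ends = end₁ e ∷ end₂ e ∷ U
  branch : Distribution
  branch = extend 1ℚ e (rgma ends G)
  extended : mass branch ≡ 1ℚ * 1ℚ × expectation branch ≡ 1ℚ * (wt e + expectation (rgma ends G))
  extended = extend-probability 1ℚ e (rgma ends G) (proj₁ (guarantee ends))
  0≤e : 0ℚ ≤ wt e
  0≤e = subst (0ℚ ≤_) (sym (proj₂ (bushEdge (in-bush (here refl))))) 0≤b
bush-guarantee b G U 0≤b antitone lipschitz guarantee (e₀ ∷ e₁ ∷ []) in-bush _ =
  trans (mass-++ (branch e₀) (branch e₁ ++ []))
        (cong₂ _+_ (proj₁ (extended e₀))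
                   (trans (cong mass (++-identityʳ (branch e₁))) (proj₁ (extended e₁)))) ,
  ≤-trans optimum-bound (≤-reflexive (sym expectation≡))
  where
  ends : Edge → List Vertex
  ends e = end₁ e ∷ end₂ e ∷ U
  branch : Edge → Distribution
  branch e = extend half e (rgma (ends e) G)
  value : Edge → ℚ
  value e = half * (wt e + expectation (rgma (ends e) G))
  extended : ∀ e → mass (branch e) ≡ half * 1ℚ × expectation (branch e) ≡ value e
  extended e = extend-probability half e (rgma (ends e) G) (proj₁ (guarantee (ends e)))

  expectation≡ : expectation (branch e₀ ++ (branch e₁ ++ [])) ≡ value e₀ + value e₁
  expectation≡ = trans (expectation-++ (branch e₀) (branch e₁ ++ []))
                   (cong₂ _+_ (proj₂ (extended e₀))
                              (trans (cong expectation (++-identityʳ (branch e₁))) (proj₂ (extended e₁))))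

  -- Whichever edge the optimum picks, the other has a residual optimum within weight b.
  picked-bound : ∀ e e′ → e ∈ bushEdges b → e′ ∈ bushEdges b →
                 twoThirds * pickValue U G e ≤ value e + value e′
  picked-bound e e′ e∈b e′∈b =
    subst₂ (λ w w′ → twoThirds * (w + opt (ends e) G)
                   ≤ half * (w + expectation (rgma (ends e) G)) + half * (w′ + expectation (rgma (ends e′) G)))
           (sym (proj₂ (bushEdge e∈b))) (sym (proj₂ (bushEdge e′∈b)))
           (two-edge-bound (weight b) (opt (ends e) G) (opt (ends e′) G)
                           (expectation (rgma (ends e) G)) (expectation (rgma (ends e′) G))
                           (proj₂ (guarantee (ends e))) (proj₂ (guarantee (ends e′)))
                           (sibling-bound b G U e e′ antitone lipschitz e∈b e′∈b))

  optimum-bound : twoThirds * optAmong U G (e₀ ∷ e₁ ∷ []) ≤ value e₀ + value e₁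
  optimum-bound with optAmong-attained U G (e₀ ∷ e₁ ∷ [])
  ... | inj₂ (_ , here refl , opt≡) =
    ≤-trans (≤-reflexive (cong (twoThirds *_) opt≡))
            (picked-bound e₀ e₁ (in-bush (here refl)) (in-bush (there (here refl))))
  ... | inj₂ (_ , there (here refl) , opt≡) =
    ≤-trans (≤-reflexive (cong (twoThirds *_) opt≡))
      (≤-trans (picked-bound e₁ e₀ (in-bush (there (here refl))) (in-bush (here refl)))
               (≤-reflexive (+-comm (value e₁) (value e₀))))
bush-guarantee b G U 0≤b antitone lipschitz guarantee (_ ∷ _ ∷ _ ∷ _) _ (s≤s (s≤s ()))

available-length : ∀ U b → length (available U b) ℕ.≤ length (leaves b)
available-length U b =
  ℕₚ.≤-trans (length-filter (Present? U) (bushEdges b))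
             (ℕₚ.≤-reflexive (length-map (λ l → edge (center b) l (weight b)) (leaves b)))

rgma-guarantee : ∀ G → NonIncreasing G → NonNegativeWeights G → AtMostTwoEdgesPerBush G →
                 ∀ U → Guarantee U G
rgma-guarantee [] _ _ _ U = refl , ≤-refl
rgma-guarantee (b ∷ G) (later≤b ∷ nonIncreasing) (0≤b ∷ nonNegative) (small ∷ atMostTwo) U =
  subst (λ D → mass D ≡ 1ℚ × twoThirds * opt U (b ∷ G) ≤ expectation D) (sym (rgma-step U b G))
        (bush-guarantee b G U 0≤b antitone (lipschitz (weight b) 0≤b later≤b)
                        (rgma-guarantee G nonIncreasing nonNegative atMostTwo)
                        (available U b) (λ e∈ → proj₁ (available⁻ b e∈))
                        (ℕₚ.≤-trans (available-length U b) small))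
  where
  antitone : Antitone G
  antitone = proj₁ (deletion-bounds G nonIncreasing nonNegative)
  lipschitz : ∀ w → 0ℚ ≤ w → WeightsAtMost w G → Lipschitz w G
  lipschitz = proj₂ (deletion-bounds G nonIncreasing nonNegative)

theorem9 : (G : BushGraph) → IsBushGraph G → AtMostTwoEdgesPerBush G →
           (opt : ℚ) → IsOPT G opt →
           ((+ 2) / 3) * opt ≤ expectedWeight G
theorem9 G (_ , _ , positive , _ , decreasing) atMostTwo _ ((M , greedy , refl) , _) = begin
  twoThirds * matchWeight M   ≤⟨ *-monoˡ-≤-nonNeg twoThirds (greedy≤opt greedy) ⟩
  twoThirds * opt [] G        ≤⟨ proj₂ (rgma-guarantee G nonIncreasing (All.map <⇒≤ positive) atMostTwo []) ⟩
  expectedWeight G            ∎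
  where
  open ≤-Reasoning
  nonIncreasing : NonIncreasing G
  nonIncreasing = AllPairs.map <⇒≤ (Linked⇒AllPairs (λ y<x z<y → <-trans z<y y<x) decreasing)
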